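{- For every integer $k \geq 1$, $\mathfrak{a}_{\mathbf{FIN}_k} \geq \aleph_1$.
   Context: Fix an integer $k \geq 1$. $\mathbf{FIN}_k$ is the set of all maps $p : \omega \to \{0,\dots,k\}$ whose support $\mathrm{supp}(p) = \{n : p(n) \neq 0\}$ is finite and such that $k \in \mathrm{ran}(p)$. For $p,q$ with disjoint supports, $p+q$ is the map equal to $p$ on $\mathrm{supp}(p)$, to $q$ on $\mathrm{supp}(q)$, and $0$ elsewhere. The tetris operation $T$ is given by $T(p)(n) = \max\{p(n)-1,0\}$. Write $p < q$ if $\max\mathrm{supp}(p) < \min\mathrm{supp}(q)$. An infinite block sequence is a sequence $P = (p_n)_{n<\omega}$ of elements of $\mathbf{FIN}_k$ with $p_n < p_{n+1}$ for all $n$; the set of these is $\mathbf{FIN}_k^{[\infty]}$. For such $P$, $\langle P \rangle$ is the set of all elements of the form $T^{j_0}(p_{n_0}) + \cdots + T^{j_m}(p_{n_m})$ with $m<\omega$, $n_0 < \cdots < n_m$, $j_0,\dots,j_m < k$ and $\min_i j_i = 0$. A set $X \subseteq \mathbf{FIN}_k$ is small if there is no $R \in \mathbf{FIN}_k^{[\infty]}$ with $\langle R \rangle \subseteq X$. Two sequences $P,Q \in \mathbf{FIN}_k^{[\infty]}$ are almost disjoint if $\langle P \rangle \cap \langle Q \rangle$ is small. A family $\mathcal{A} \subseteq \mathbf{FIN}_k^{[\infty]}$ is almost disjoint if any two distinct members are almost disjoint, and it is a mad family if it is maximal under inclusion among almost disjoint families. $\mathfrak{a}_{\mathbf{FIN}_k}$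 denotes the smallest cardinality of an infinite mad family in $\mathbf{FIN}_k^{[\infty]}$. -}

module Defs where

open import Data.Nat using (ℕ; zero; suc; _+_; _∸_; _≤_; _<_)
open import Data.Product using (Σ; ∃; _×_; _,_; proj₁; proj₂)
open import Data.Sum using (_⊎_)
open import Data.Unit using (⊤)
open import Data.List using (List; []; _∷_)
open import Data.List.Relation.Unary.All using (All)
open import Data.List.Relation.Unary.Any using (Any)
open import Relation.Binary.PropositionalEquality using (_≡_; _≢_)
open import Relation.Nullary using (¬_)

record FIN (k : ℕ) : Set where
  field
    val     : ℕ → ℕ
    bounded : ∀ n → val n ≤ k
    finSupp : ∃ λ N → ∀ n → N ≤ n → val n ≡ 0
    hitsK   : ∃ λ n → val n ≡ k
open FIN public

-- p < q : max supp(p) < min supp(q)  (supports are nonempty since k ≥ 1)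
_≺_ : ∀ {k} → FIN k → FIN k → Set
p ≺ q = ∀ m n → val p m ≢ 0 → val q n ≢ 0 → m < n

record BlockSeq (k : ℕ) : Set where
  field
    blk  : ℕ → FIN k
    incr : ∀ n → blk n ≺ blk (suc n)
open BlockSeq public

-- Tetris iterate: T^j(p)(n) = p(n) ∸ j
Tet : ℕ → (ℕ → ℕ) → (ℕ → ℕ)
Tet j p n = p n ∸ j

StrictlyIncr : List (ℕ × ℕ) → Set
StrictlyIncr [] = ⊤
StrictlyIncr (x ∷ []) = ⊤
StrictlyIncr (x ∷ y ∷ l) = (proj₁ x < proj₁ y) × StrictlyIncr (y ∷ l)

-- T^{j₀}(p_{n₀}) + ⋯ + T^{j_m}(p_{n_m}); the supports are pairwise disjoint,
-- so the disjoint-support sum p+q coincides with the pointwise sum.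
evalRecipe : ∀ {k} → BlockSeq k → List (ℕ × ℕ) → ℕ → ℕ
evalRecipe P [] x = 0
evalRecipe P ((n , j) ∷ l) x = Tet j (val (blk P n)) x + evalRecipe P l x

_∈⟨_⟩ : ∀ {k} → FIN k → BlockSeq k → Set
_∈⟨_⟩ {k} p P =
  ∃ λ (L : List (ℕ × ℕ)) →
    StrictlyIncr L
    × All (λ nj → proj₂ nj < k) L
    × Any (λ nj → proj₂ nj ≡ 0) L      -- min j_i = 0 (also forces L nonempty)
    × (∀ x → val p x ≡ evalRecipe P L x)

Small : ∀ {k} → (FIN k → Set) → Set
Small {k} X = ¬ (∃ λ (R : BlockSeq k) → ∀ p → p ∈⟨ R ⟩ → X p)

AlmostDisjoint : ∀ {k} → BlockSeq k → BlockSeq k → Set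
AlmostDisjoint P Q = Small (λ p → (p ∈⟨ P ⟩) × (p ∈⟨ Q ⟩))

_≐_ : ∀ {k} → BlockSeq k → BlockSeq k → Set
P ≐ Q = ∀ n x → val (blk P n) x ≡ val (blk Q n) x

-- A countable family {A i : i ∈ ℕ} that is almost disjoint, with distinct indices
-- giving almost disjoint (hence distinct) members: a countably infinite AD family.
IsADSeq : ∀ {k} → (ℕ → BlockSeq k) → Set
IsADSeq A = ∀ i j → i ≢ j → AlmostDisjoint (A i) (A j)

IsMaximal : ∀ {k} → (ℕ → BlockSeq k) → Set
IsMaximal {k} A = ∀ (Q : BlockSeq k) →
  (∀ i → (Q ≐ A i) ⊎ AlmostDisjoint Q (A i)) → ∃ λ i → Q ≐ A i

{-# OPTIONS --safe #-}
-- From a countable almost disjoint family (Aᵢ) we build Q almost disjoint from every Aᵢ;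
-- maximality would then give Q ≐ Aᵢ for some i, which is absurd.
-- Block n of Q concatenates pieces, one for each i ≤ n, in disjoint regions. Piece i starts
-- from a "probe" b, a far-out block of A(i+1). If some point of supp b is an escape point d
-- for Aᵢ (covered by no block of Aᵢ, or covered by a block with a peak c ≠ d in the region),
-- the piece is k·δ_d: an element of ⟨Aᵢ⟩ vanishing on the rest of the region avoids that
-- block, hence vanishes at d, so it cannot dominate this block of Q. Otherwise every point y
-- of supp b carries a block k·δ_y of Aᵢ, and the piece is b itself.
-- So if ⟨R⟩ ⊆ ⟨Q⟩ ∩ ⟨Aᵢ⟩, there are arbitrarily far probes of the second kind; they form a
-- subsequence R′ of A(i+1) with ⟨R′⟩ ⊆ ⟨Aᵢ⟩ ∩ ⟨A(i+1)⟩, contradicting almost disjointness.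

module Submission where

open import Defs
open import Data.Nat using (ℕ; zero; suc; _+_; _∸_; _≤_; _<_; _≥_; z≤n; s≤s; _≟_; _⊔_; _≤?_)
open import Data.Nat.Properties
open import Data.Product using (∃; ∃₂; _×_; _,_; proj₁; proj₂; map₁)
open import Data.Sum using (_⊎_; inj₁; inj₂; [_,_]; map₂)
open import Data.Unit using (tt)
open import Data.Empty using (⊥-elim)
open import Data.List using (List; []; _∷_; map)
open import Data.List.Relation.Unary.All as All using (All; []; _∷_)
import Data.List.Relation.Unary.All.Properties as All
open import Data.List.Relation.Unary.Any using (Any; here; there)
import Data.List.Relation.Unary.Any.Properties as Any
open import Relation.Binary.PropositionalEquality using (_≡_; _≢_; refl; sym; trans; cong; cong₂; subst; ≢-sym)
open import Relation.Binary using (tri<; tri≈; tri>)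
open import Relation.Nullary using (¬_; yes; no)
open import Relation.Nullary.Decidable using (decidable-stable)

infix 4 _≤_<_
_≤_<_ : ℕ → ℕ → ℕ → Set
lo ≤ z < hi = (lo ≤ z) × (z < hi)

step⇒monotone : (f : ℕ → ℕ) → (∀ n → f n ≤ f (suc n)) → ∀ {m n} → m ≤ n → f m ≤ f n
step⇒monotone f step {n = zero} z≤n = ≤-refl
step⇒monotone f step {n = suc n} m≤1+n with m≤n⇒m<n∨m≡n m≤1+n
... | inj₁ m<1+n = ≤-trans (step⇒monotone f step (≤-pred m<1+n)) (step n)
... | inj₂ refl = ≤-refl

step⇒strictMono : (f : ℕ → ℕ) → (∀ n → f n < f (suc n)) → ∀ {m n} → m < n → f m < f n
step⇒strictMono f step {m} m<n = <-≤-trans (step m) (step⇒monotone f (λ n → <⇒≤ (step n)) m<n)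

finite-dichotomy : ∀ {G S : ℕ → Set} n → (∀ y → y < n → G y ⊎ S y) →
                   (∃ λ y → y < n × G y) ⊎ (∀ y → y < n → S y)
finite-dichotomy zero _ = inj₂ (λ _ ())
finite-dichotomy (suc n) g⊎s with finite-dichotomy n (λ y y<n → g⊎s y (m<n⇒m<1+n y<n))
... | inj₁ (y , y<n , g) = inj₁ (y , m<n⇒m<1+n y<n , g)
... | inj₂ below with g⊎s n ≤-refl
...   | inj₁ g = inj₁ (n , ≤-refl , g)
...   | inj₂ s = inj₂ (λ y y<1+n → [ below y , (λ { refl → s }) ] (m<1+n⇒m<n∨m≡n y<1+n))

∷-strictlyIncr : ∀ {e L} → All (λ e′ → proj₁ e < proj₁ e′) L → StrictlyIncr L → StrictlyIncr (e ∷ L)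
∷-strictlyIncr {L = []} _ _ = tt
∷-strictlyIncr {L = _ ∷ _} (e<e′ ∷ _) incr = e<e′ , incr

map-strictlyIncr : (f : ℕ → ℕ) → (∀ {m n} → m < n → f m < f n) →
                   ∀ L → StrictlyIncr L → StrictlyIncr (map (map₁ f) L)
map-strictlyIncr f f-mono [] _ = tt
map-strictlyIncr f f-mono (_ ∷ []) _ = tt
map-strictlyIncr f f-mono (_ ∷ e ∷ L) (lt , incr) = f-mono lt , map-strictlyIncr f f-mono (e ∷ L) incr

suppBound : ∀ {k} → FIN k → ℕ
suppBound p = proj₁ (finSupp p)

supp<suppBound : ∀ {k} (p : FIN k) {y} → val p y ≢ 0 → y < suppBound p
supp<suppBound p {y} p≢0 with suppBound p ≤? y
... | yes N≤y = ⊥-elim (p≢0 (proj₂ (finSupp p) y N≤y))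
... | no N≰y = ≰⇒> N≰y

peak : ∀ {k} → FIN k → ℕ
peak p = proj₁ (hitsK p)

∈⟨⟩-resp-≐ : ∀ {k} (P Q : BlockSeq k) → P ≐ Q → ∀ p → p ∈⟨ P ⟩ → p ∈⟨ Q ⟩
∈⟨⟩-resp-≐ P Q P≐Q p (L , incr , j<k , j≡0 , p≡) = L , incr , j<k , j≡0 , λ z → trans (p≡ z) (eval≡ L z)
  where
    eval≡ : ∀ L z → evalRecipe P L z ≡ evalRecipe Q L z
    eval≡ [] z = refl
    eval≡ ((n , j) ∷ L) z = cong₂ _+_ (cong (_∸ j) (P≐Q n z)) (eval≡ L z)

≐⇒¬AlmostDisjoint : ∀ {k} {P Q : BlockSeq k} → P ≐ Q → ¬ AlmostDisjoint P Q
≐⇒¬AlmostDisjoint {P = P} {Q} P≐Q ad = ad (P , λ p p∈P → p∈P , ∈⟨⟩-resp-≐ P Q P≐Q p p∈P)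

module _ {k : ℕ} where

  pointVal : ℕ → ℕ → ℕ
  pointVal d z with z ≟ d
  ... | yes _ = k
  ... | no _ = 0

  pointVal-same : ∀ d → pointVal d d ≡ k
  pointVal-same d with d ≟ d
  ... | yes _ = refl
  ... | no d≢d = ⊥-elim (d≢d refl)

  pointVal-other : ∀ {d z} → z ≢ d → pointVal d z ≡ 0
  pointVal-other {d} {z} z≢d with z ≟ d
  ... | yes z≡d = ⊥-elim (z≢d z≡d)
  ... | no _ = refl

  pointVal-≢0 : ∀ {d z} → pointVal d z ≢ 0 → z ≡ d
  pointVal-≢0 {d} {z} ≢0 with z ≟ d
  ... | yes z≡d = z≡d
  ... | no _ = ⊥-elim (≢0 refl)

  pointVal-≤ : ∀ d z → pointVal d z ≤ k
  pointVal-≤ d z with z ≟ d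
  ... | yes _ = ≤-refl
  ... | no _ = z≤n

  point : ℕ → FIN k
  point d = record
    { val = pointVal d
    ; bounded = pointVal-≤ d
    ; finSupp = suc d , λ z d<z → pointVal-other (>⇒≢ d<z)
    ; hitsK = d , pointVal-same d
    }

module _ {k : ℕ} (k≥1 : k ≥ 1) where

  ≡k⇒≢0 : ∀ {a} → a ≡ k → a ≢ 0
  ≡k⇒≢0 a≡k a≡0 = >⇒≢ k≥1 (trans (sym a≡k) a≡0)

  peak-≢0 : (p : FIN k) → val p (peak p) ≢ 0
  peak-≢0 p = ≡k⇒≢0 (proj₂ (hitsK p))

  index≤supp : (P : BlockSeq k) (m : ℕ) {z : ℕ} → val (blk P m) z ≢ 0 → m ≤ z
  index≤supp P zero _ = z≤n
  index≤supp P (suc m) {z} ≢0 =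
    ≤-<-trans (index≤supp P m (peak-≢0 (blk P m))) (incr P m _ z (peak-≢0 (blk P m)) ≢0)

  supp-ordered : (P : BlockSeq k) → ∀ {m m′ u v} → m < m′ →
                 val (blk P m) u ≢ 0 → val (blk P m′) v ≢ 0 → u < v
  supp-ordered P {m} {suc m′} m<1+m′ u≢0 v≢0 with m<1+n⇒m<n∨m≡n m<1+m′
  ... | inj₂ refl = incr P m _ _ u≢0 v≢0
  ... | inj₁ m<m′ = <-trans (supp-ordered P m<m′ u≢0 (peak-≢0 (blk P m′)))
                            (incr P m′ _ _ (peak-≢0 (blk P m′)) v≢0)

  supp-disjoint : (P : BlockSeq k) → ∀ {m m′ z} → m′ ≢ m → val (blk P m) z ≢ 0 → val (blk P m′) z ≡ 0
  supp-disjoint P {m} {m′} {z} m′≢m ≢0 = decidable-stable (val (blk P m′) z ≟ 0) disjoint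
    where
      disjoint : ¬ (val (blk P m′) z ≢ 0)
      disjoint ≢0′ with <-cmp m m′
      ... | tri< m<m′ _ _ = <-irrefl refl (supp-ordered P m<m′ ≢0 ≢0′)
      ... | tri≈ _ m≡m′ _ = m′≢m (sym m≡m′)
      ... | tri> _ _ m′<m = <-irrefl refl (supp-ordered P m′<m ≢0′ ≢0)

  supp<suppBound-of-later : (P : BlockSeq k) → ∀ {m n z} → m ≤ n → val (blk P m) z ≢ 0 → z < suppBound (blk P n)
  supp<suppBound-of-later P {m} {n} m≤n ≢0 with m≤n⇒m<n∨m≡n m≤n
  ... | inj₂ refl = supp<suppBound (blk P m) ≢0
  ... | inj₁ m<n = <-trans (supp-ordered P m<n ≢0 (peak-≢0 (blk P n))) (supp<suppBound (blk P n) (peak-≢0 (blk P n)))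

  Uncovered : BlockSeq k → ℕ → Set
  Uncovered P z = ∀ m → val (blk P m) z ≡ 0

  uncovered-or-covered : (P : BlockSeq k) (z : ℕ) → Uncovered P z ⊎ ∃ λ m → val (blk P m) z ≢ 0
  uncovered-or-covered P z with finite-dichotomy (suc z) (λ m _ → test m)
    where
      test : ∀ m → val (blk P m) z ≢ 0 ⊎ val (blk P m) z ≡ 0
      test m with val (blk P m) z ≟ 0
      ... | yes ≡0 = inj₂ ≡0
      ... | no ≢0 = inj₁ ≢0
  ... | inj₁ (m , _ , ≢0) = inj₂ (m , ≢0)
  ... | inj₂ below = inj₁ λ m → decidable-stable (val (blk P m) z ≟ 0)
                                 (λ ≢0 → ≢0 (below m (s≤s (index≤supp P m ≢0))))

  evalRecipe-vanishes : (P : BlockSeq k) (L : List (ℕ × ℕ)) {z : ℕ} → Uncovered P z → evalRecipe P L z ≡ 0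
  evalRecipe-vanishes P [] _ = refl
  evalRecipe-vanishes P ((n , j) ∷ L) {z} unc rewrite unc n | 0∸n≡0 j = evalRecipe-vanishes P L unc

  evalRecipe-supp : (P : BlockSeq k) (L : List (ℕ × ℕ)) {z : ℕ} → evalRecipe P L z ≢ 0 →
                    ∃ λ m → val (blk P m) z ≢ 0
  evalRecipe-supp P [] ≢0 = ⊥-elim (≢0 refl)
  evalRecipe-supp P ((n , j) ∷ L) {z} ≢0 with val (blk P n) z ≟ 0
  ... | no n≢0 = n , n≢0
  ... | yes n≡0 rewrite n≡0 | 0∸n≡0 j = evalRecipe-supp P L ≢0

  evalRecipe-dominates : (P : BlockSeq k) (L : List (ℕ × ℕ)) → Any (λ nj → proj₂ nj ≡ 0) L →
                         ∃ λ n → ∀ z → val (blk P n) z ≤ evalRecipe P L z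
  evalRecipe-dominates P ((n , .0) ∷ L) (here refl) = n , λ z → m≤m+n (val (blk P n) z) _
  evalRecipe-dominates P ((n , j) ∷ L) (there j≡0) with evalRecipe-dominates P L j≡0
  ... | m , ≤eval = m , λ z → ≤-trans (≤eval z) (m≤n+m _ _)

  -- A recipe vanishing at a peak c of block m cannot use block m (it would contribute k ∸ j > 0
  -- at c), and at d only block m can contribute.
  evalRecipe-≡0-at-peak : (P : BlockSeq k) (L : List (ℕ × ℕ)) → All (λ nj → proj₂ nj < k) L → ∀ {m c d} →
                          val (blk P m) c ≡ k → (∀ m′ → m′ ≢ m → val (blk P m′) d ≡ 0) →
                          evalRecipe P L c ≡ 0 → evalRecipe P L d ≡ 0
  evalRecipe-≡0-at-peak P [] _ _ _ _ = refl
  evalRecipe-≡0-at-peak P ((n , j) ∷ L) (j<k ∷ j<ks) {m} {c} c≡k others ≡0 with n ≟ m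
  ... | yes refl = ⊥-elim (<⇒≱ j<k (m∸n≡0⇒m≤n (trans (cong (_∸ j) (sym c≡k)) (m+n≡0⇒m≡0 _ ≡0))))
  ... | no n≢m rewrite others n n≢m | 0∸n≡0 j = evalRecipe-≡0-at-peak P L j<ks c≡k others (m+n≡0⇒n≡0 _ ≡0)

  module _ (P : BlockSeq k) (p : FIN k) (p∈P : p ∈⟨ P ⟩) where

    private
      L = proj₁ p∈P
      p≡eval = proj₂ (proj₂ (proj₂ (proj₂ p∈P)))

    ∈⟨⟩-vanishes : ∀ {z} → Uncovered P z → val p z ≡ 0
    ∈⟨⟩-vanishes unc = trans (p≡eval _) (evalRecipe-vanishes P L unc)

    ∈⟨⟩-supp : ∀ {z} → val p z ≢ 0 → ∃ λ m → val (blk P m) z ≢ 0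
    ∈⟨⟩-supp ≢0 = evalRecipe-supp P L (λ ≡0 → ≢0 (trans (p≡eval _) ≡0))

    ∈⟨⟩-dominates : ∃ λ n → ∀ z → val (blk P n) z ≤ val p z
    ∈⟨⟩-dominates with evalRecipe-dominates P L (proj₁ (proj₂ (proj₂ (proj₂ p∈P))))
    ... | n , ≤eval = n , λ z → subst (val (blk P n) z ≤_) (sym (p≡eval z)) (≤eval z)

    ∈⟨⟩-≡0-at-peak : ∀ {m c d} → val (blk P m) c ≡ k → (∀ m′ → m′ ≢ m → val (blk P m′) d ≡ 0) →
                     val p c ≡ 0 → val p d ≡ 0
    ∈⟨⟩-≡0-at-peak c≡k others c≡0 =
      trans (p≡eval _) (evalRecipe-≡0-at-peak P L (proj₁ (proj₂ (proj₂ p∈P))) c≡k others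
                          (trans (sym (p≡eval _)) c≡0))

  blk-∈⟨⟩ : (P : BlockSeq k) (n : ℕ) → blk P n ∈⟨ P ⟩
  blk-∈⟨⟩ P n = ((n , 0) ∷ []) , tt , (k≥1 ∷ []) , here refl , λ z → sym (+-identityʳ _)

  subseq : (P : BlockSeq k) (f : ℕ → ℕ) → (∀ t → f t < f (suc t)) → BlockSeq k
  subseq P f f-step = record
    { blk = λ t → blk P (f t)
    ; incr = λ t u v → supp-ordered P (f-step t)
    }

  subseq-⊆ : (P : BlockSeq k) (f : ℕ → ℕ) (f-step : ∀ t → f t < f (suc t)) (p : FIN k) →
             p ∈⟨ subseq P f f-step ⟩ → p ∈⟨ P ⟩
  subseq-⊆ P f f-step p (L , incr , j<k , j≡0 , p≡) =
    map (map₁ f) L , map-strictlyIncr f (step⇒strictMono f f-step) L incr ,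
    All.map⁺ j<k , Any.map⁺ j≡0 , λ z → trans (p≡ z) (eval-map L z)
    where
      eval-map : ∀ L z → evalRecipe (subseq P f f-step) L z ≡ evalRecipe P (map (map₁ f) L) z
      eval-map [] z = refl
      eval-map ((t , j) ∷ L) z = cong (_ +_) (eval-map L z)

  IsPointAt : FIN k → ℕ → Set
  IsPointAt p y = val p y ≡ k × (∀ z → z ≢ y → val p z ≡ 0)

  PointBlock : BlockSeq k → ℕ → Set
  PointBlock P y = ∃ λ m → IsPointAt (blk P m) y

  pointAt-index< : (P : BlockSeq k) → ∀ {m m′ s z} →
                   IsPointAt (blk P m) s → s < z → val (blk P m′) z ≢ 0 → m < m′
  pointAt-index< P {m} {m′} (s≡k , off) s<z ≢0 with <-cmp m m′
  ... | tri< m<m′ _ _ = m<m′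
  ... | tri≈ _ refl _ = ⊥-elim (≢0 (off _ (>⇒≢ s<z)))
  ... | tri> _ _ m′<m = ⊥-elim (<-asym s<z (supp-ordered P m′<m ≢0 (≡k⇒≢0 s≡k)))

  -- x = Σ_y T^(k ∸ x y) (b_y) over supp x, with b_y the point block of P at y;
  -- recipe s c collects the terms with s ≤ y < s + c.
  module PointRecipe (P : BlockSeq k) (x : FIN k) (pts : ∀ y → val x y ≢ 0 → PointBlock P y) where

    recipe : ℕ → ℕ → List (ℕ × ℕ)
    recipe s zero = []
    recipe s (suc c) with val x s ≟ 0
    ... | yes _ = recipe (suc s) c
    ... | no x≢0 = (proj₁ (pts s x≢0) , k ∸ val x s) ∷ recipe (suc s) c

    entry-at : ∀ s (x≢0 : val x s ≢ 0) → val (blk P (proj₁ (pts s x≢0))) s ∸ (k ∸ val x s) ≡ val x s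
    entry-at s x≢0 rewrite proj₁ (proj₂ (pts s x≢0)) = m∸[m∸n]≡n (bounded x s)

    entry-off : ∀ s (x≢0 : val x s ≢ 0) {z} → z ≢ s → val (blk P (proj₁ (pts s x≢0))) z ∸ (k ∸ val x s) ≡ 0
    entry-off s x≢0 z≢s rewrite proj₂ (proj₂ (pts s x≢0)) _ z≢s = 0∸n≡0 (k ∸ val x s)

    recipe-j<k : ∀ s c → All (λ nj → proj₂ nj < k) (recipe s c)
    recipe-j<k s zero = []
    recipe-j<k s (suc c) with val x s ≟ 0
    ... | yes _ = recipe-j<k (suc s) c
    ... | no x≢0 = ∸-monoʳ-< (n≢0⇒n>0 x≢0) (bounded x s) ∷ recipe-j<k (suc s) c

    Later : ℕ → ℕ × ℕ → Set
    Later s e = ∃ λ z → s ≤ z × val (blk P (proj₁ e)) z ≢ 0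

    later-weaken : ∀ {s e} → Later (suc s) e → Later s e
    later-weaken (z , s<z , ≢0) = z , <⇒≤ s<z , ≢0

    recipe-later : ∀ s c → All (Later s) (recipe s c)
    recipe-later s zero = []
    recipe-later s (suc c) with val x s ≟ 0
    ... | yes _ = All.map (λ {e} → later-weaken {s} {e}) (recipe-later (suc s) c)
    ... | no x≢0 = (s , ≤-refl , ≡k⇒≢0 (proj₁ (proj₂ (pts s x≢0))))
                 ∷ All.map (λ {e} → later-weaken {s} {e}) (recipe-later (suc s) c)

    recipe-incr : ∀ s c → StrictlyIncr (recipe s c)
    recipe-incr s zero = tt
    recipe-incr s (suc c) with val x s ≟ 0
    ... | yes _ = recipe-incr (suc s) c
    ... | no x≢0 = ∷-strictlyIncr (All.map (λ (_ , s<z , ≢0) → pointAt-index< P (proj₂ (pts s x≢0)) s<z ≢0)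
                                           (recipe-later (suc s) c))
                                  (recipe-incr (suc s) c)

    recipe-below : ∀ s c {z} → z < s → evalRecipe P (recipe s c) z ≡ 0
    recipe-below s zero z<s = refl
    recipe-below s (suc c) z<s with val x s ≟ 0
    ... | yes _ = recipe-below (suc s) c (m<n⇒m<1+n z<s)
    ... | no x≢0 = cong₂ _+_ (entry-off s x≢0 (<⇒≢ z<s)) (recipe-below (suc s) c (m<n⇒m<1+n z<s))

    bound-base : ∀ {s} → suppBound x ≤ s + 0 → suppBound x ≤ s
    bound-base {s} = subst (suppBound x ≤_) (+-identityʳ s)

    bound-step : ∀ {s c} → suppBound x ≤ s + suc c → suppBound x ≤ suc s + c
    bound-step {s} {c} = subst (suppBound x ≤_) (+-suc s c)

    recipe-eval : ∀ s c {z} → suppBound x ≤ s + c → s ≤ z → evalRecipe P (recipe s c) z ≡ val x z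
    recipe-eval s zero N≤s s≤z = sym (proj₂ (finSupp x) _ (≤-trans (bound-base N≤s) s≤z))
    recipe-eval s (suc c) N≤ s≤z with val x s ≟ 0 | m≤n⇒m<n∨m≡n s≤z
    ... | yes _ | inj₁ s<z = recipe-eval (suc s) c (bound-step N≤) s<z
    ... | yes x≡0 | inj₂ refl = trans (recipe-below (suc s) c ≤-refl) (sym x≡0)
    ... | no x≢0 | inj₁ s<z = cong₂ _+_ (entry-off s x≢0 (>⇒≢ s<z)) (recipe-eval (suc s) c (bound-step N≤) s<z)
    ... | no x≢0 | inj₂ refl = trans (cong₂ _+_ (entry-at s x≢0) (recipe-below (suc s) c ≤-refl)) (+-identityʳ _)

    recipe-full : ∀ s c → suppBound x ≤ s + c → s ≤ peak x → Any (λ nj → proj₂ nj ≡ 0) (recipe s c)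
    recipe-full s zero N≤s s≤w =
      ⊥-elim (<⇒≱ (supp<suppBound x (peak-≢0 x)) (≤-trans (bound-base N≤s) s≤w))
    recipe-full s (suc c) N≤ s≤w with val x s ≟ 0 | m≤n⇒m<n∨m≡n s≤w
    ... | yes _ | inj₁ s<w = recipe-full (suc s) c (bound-step N≤) s<w
    ... | no _ | inj₁ s<w = there (recipe-full (suc s) c (bound-step N≤) s<w)
    ... | yes x≡0 | inj₂ refl = ⊥-elim (peak-≢0 x x≡0)
    ... | no _ | inj₂ refl = here (subst (λ v → k ∸ v ≡ 0) (sym (proj₂ (hitsK x))) (n∸n≡0 k))

  pointBlocks⇒∈⟨⟩ : (P : BlockSeq k) (x : FIN k) → (∀ y → val x y ≢ 0 → PointBlock P y) → x ∈⟨ P ⟩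
  pointBlocks⇒∈⟨⟩ P x pts =
    recipe 0 N , recipe-incr 0 N , recipe-j<k 0 N , recipe-full 0 N ≤-refl z≤n ,
    λ z → sym (recipe-eval 0 N ≤-refl z≤n)
    where
      open PointRecipe P x pts
      N = suppBound x

  Wide : FIN k → Set
  Wide p = ∃₂ λ c d → c ≢ d × val p c ≡ k × val p d ≢ 0

  peak-point-or-wide : (p : FIN k) → IsPointAt p (peak p) ⊎ Wide p
  peak-point-or-wide p with finite-dichotomy (suppBound p) (λ d _ → other-point? d)
    where
      other-point? : ∀ d → (d ≢ peak p × val p d ≢ 0) ⊎ (d ≢ peak p → val p d ≡ 0)
      other-point? d with d ≟ peak p | val p d ≟ 0
      ... | yes refl | _ = inj₂ (λ d≢d → ⊥-elim (d≢d refl))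
      ... | no _ | yes ≡0 = inj₂ (λ _ → ≡0)
      ... | no d≢c | no ≢0 = inj₁ (d≢c , ≢0)
  ... | inj₁ (d , _ , d≢c , ≢0) = inj₂ (peak p , d , ≢-sym d≢c , proj₂ (hitsK p) , ≢0)
  ... | inj₂ none = inj₁ (proj₂ (hitsK p) , λ z z≢c →
                      decidable-stable (val p z ≟ 0) (λ ≢0 → ≢0 (none z (supp<suppBound p ≢0) z≢c)))

  pointAt-or-wide : (p : FIN k) → ∀ {y} → val p y ≢ 0 → IsPointAt p y ⊎ Wide p
  pointAt-or-wide p {y} ≢0 with peak p ≟ y
  ... | yes refl = peak-point-or-wide p
  ... | no c≢y = inj₂ (peak p , y , c≢y , proj₂ (hitsK p) , ≢0)

  Escapes : BlockSeq k → ℕ → ℕ → ℕ → Set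
  Escapes P lo hi d =
    (lo ≤ d < hi) × (∀ x → x ∈⟨ P ⟩ → (∀ z → lo ≤ z < hi → z ≢ d → val x z ≡ 0) → val x d ≡ 0)

  uncovered-escapes : ∀ {P : BlockSeq k} {lo hi d} → Uncovered P d → lo ≤ d < hi → Escapes P lo hi d
  uncovered-escapes {P} unc d∈ = d∈ , λ x x∈P _ → ∈⟨⟩-vanishes P x x∈P unc

  wide-escapes : (P : BlockSeq k) → ∀ {m c d lo hi} → val (blk P m) c ≡ k → c ≢ d → val (blk P m) d ≢ 0 →
                 lo ≤ c < hi → lo ≤ d < hi → Escapes P lo hi d
  wide-escapes P c≡k c≢d ≢0 c∈ d∈ =
    d∈ , λ x x∈P off →
      ∈⟨⟩-≡0-at-peak P x x∈P c≡k (λ m′ m′≢m → supp-disjoint P m′≢m ≢0) (off _ c∈ c≢d)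

  module Glue (p : ℕ → FIN k) (r : ℕ → ℕ) (p-supp : ∀ c {z} → val (p c) z ≢ 0 → r c ≤ z < r (suc c)) where

    r-step : ∀ c → r c < r (suc c)
    r-step c = let (lo , hi) = p-supp c (peak-≢0 (p c)) in ≤-<-trans lo hi

    r-mono : ∀ {c c′} → c ≤ c′ → r c ≤ r c′
    r-mono = step⇒monotone r (λ c → <⇒≤ (r-step c))

    p-outside : ∀ c {z} → z < r c ⊎ r (suc c) ≤ z → val (p c) z ≡ 0
    p-outside c {z} out = decidable-stable (val (p c) z ≟ 0) λ ≢0 →
      let (lo , hi) = p-supp c ≢0 in [ (λ z<r → <⇒≱ z<r lo) , (λ r≤z → <⇒≱ hi r≤z) ] out

    sumUpTo : ℕ → ℕ → ℕ
    sumUpTo zero z = 0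
    sumUpTo (suc c) z = sumUpTo c z + val (p c) z

    sum-outside : ∀ c {z} → z < r 0 ⊎ r c ≤ z → sumUpTo c z ≡ 0
    sum-outside zero _ = refl
    sum-outside (suc c) (inj₁ z<r₀) =
      cong₂ _+_ (sum-outside c (inj₁ z<r₀)) (p-outside c (inj₁ (<-≤-trans z<r₀ (r-mono z≤n))))
    sum-outside (suc c) (inj₂ r≤z) =
      cong₂ _+_ (sum-outside c (inj₂ (≤-trans (<⇒≤ (r-step c)) r≤z))) (p-outside c (inj₂ r≤z))

    sum-inside : ∀ c {i z} → i < c → r i ≤ z < r (suc i) → sumUpTo c z ≡ val (p i) z
    sum-inside (suc c) {i} i<1+c (lo , hi) with m<1+n⇒m<n∨m≡n i<1+c
    ... | inj₂ refl = cong (_+ val (p i) _) (sum-outside i (inj₂ lo))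
    ... | inj₁ i<c = trans (cong₂ _+_ (sum-inside c i<c (lo , hi)) (p-outside c (inj₁ (<-≤-trans hi (r-mono i<c)))))
                           (+-identityʳ _)

    sum-≤ : ∀ c z → sumUpTo c z ≤ k
    sum-≤ zero z = z≤n
    sum-≤ (suc c) z with r c ≤? z
    ... | yes r≤z rewrite sum-outside c (inj₂ r≤z) = bounded (p c) z
    ... | no r≰z rewrite p-outside c (inj₁ (≰⇒> r≰z)) | +-identityʳ (sumUpTo c z) = sum-≤ c z

    sum-supp : ∀ c {z} → sumUpTo c z ≢ 0 → r 0 ≤ z < r c
    sum-supp c {z} ≢0 with r 0 ≤? z | r c ≤? z
    ... | no r₀≰z | _ = ⊥-elim (≢0 (sum-outside c (inj₁ (≰⇒> r₀≰z))))
    ... | yes _ | yes r≤z = ⊥-elim (≢0 (sum-outside c (inj₂ r≤z)))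
    ... | yes r₀≤z | no r≰z = r₀≤z , ≰⇒> r≰z

    glue : ℕ → FIN k
    glue n = record
      { val = sumUpTo (suc n)
      ; bounded = sum-≤ (suc n)
      ; finSupp = r (suc n) , λ z r≤z → sum-outside (suc n) (inj₂ r≤z)
      ; hitsK = peak (p 0) , trans (sum-inside (suc n) (s≤s z≤n) (p-supp 0 (peak-≢0 (p 0)))) (proj₂ (hitsK (p 0)))
      }

module Construction {k : ℕ} (k≥1 : k ≥ 1) (A : ℕ → BlockSeq k) where

  -- probeIndex forces every block of Aᵢ meeting the probe to have index > L, hence to start
  -- after L; such a block has index < suppBound (probe L i), hence ends before pieceEnd L i.
  probeIndex : ℕ → ℕ → ℕ
  probeIndex L i = L ⊔ suppBound (blk (A i) L)

  probe : ℕ → ℕ → FIN k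
  probe L i = blk (A (suc i)) (probeIndex L i)

  pieceEnd : ℕ → ℕ → ℕ
  pieceEnd L i = suppBound (probe L i) ⊔ suppBound (blk (A i) (suppBound (probe L i)))

  probe-supp : ∀ L i {y} → val (probe L i) y ≢ 0 → probeIndex L i ≤ y < pieceEnd L i
  probe-supp L i ≢0 =
    index≤supp k≥1 (A (suc i)) _ ≢0 , <-≤-trans (supp<suppBound (probe L i) ≢0) (m≤m⊔n _ _)

  probe-in-region : ∀ L i {y} → val (probe L i) y ≢ 0 → L ≤ y < pieceEnd L i
  probe-in-region L i ≢0 = let (lo , hi) = probe-supp L i ≢0 in ≤-trans (m≤m⊔n _ _) lo , hi

  cover-in-region : ∀ L i {y m w} → val (probe L i) y ≢ 0 → val (blk (A i) m) y ≢ 0 →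
                    val (blk (A i) m) w ≢ 0 → L ≤ w < pieceEnd L i
  cover-in-region L i {y} {m} probe≢0 y≢0 w≢0 =
    ≤-trans L≤m (index≤supp k≥1 (A i) m w≢0) ,
    <-≤-trans (supp<suppBound-of-later k≥1 (A i) m≤bound w≢0) (m≤n⊔m _ _)
    where
      L≤m : L ≤ m
      L≤m with L ≤? m
      ... | yes L≤m = L≤m
      ... | no L≰m = ⊥-elim (<⇒≱ (supp<suppBound-of-later k≥1 (A i) (<⇒≤ (≰⇒> L≰m)) y≢0)
                                 (≤-trans (m≤n⊔m L _) (proj₁ (probe-supp L i probe≢0))))
      m≤bound : m ≤ suppBound (probe L i)
      m≤bound = <⇒≤ (≤-<-trans (index≤supp k≥1 (A i) m y≢0) (supp<suppBound (probe L i) probe≢0))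

  HasEscape : ℕ → ℕ → Set
  HasEscape L i = ∃ (Escapes k≥1 (A i) L (pieceEnd L i))

  ProbeOnPointBlocks : ℕ → ℕ → Set
  ProbeOnPointBlocks L i = ∀ y → val (probe L i) y ≢ 0 → PointBlock k≥1 (A i) y

  escape-or-pointBlock : ∀ L i {y} → val (probe L i) y ≢ 0 → HasEscape L i ⊎ PointBlock k≥1 (A i) y
  escape-or-pointBlock L i {y} probe≢0 with uncovered-or-covered k≥1 (A i) y
  ... | inj₁ unc = inj₁ (y , uncovered-escapes k≥1 unc (probe-in-region L i probe≢0))
  ... | inj₂ (m , y≢0) with pointAt-or-wide k≥1 (blk (A i) m) y≢0
  ...   | inj₁ isPoint = inj₂ (m , isPoint)
  ...   | inj₂ (c , d , c≢d , c≡k , d≢0) =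
          inj₁ (d , wide-escapes k≥1 (A i) c≡k c≢d d≢0 (cover-in-region L i probe≢0 y≢0 (≡k⇒≢0 k≥1 c≡k))
                                                        (cover-in-region L i probe≢0 y≢0 d≢0))

  classify : ∀ L i → HasEscape L i ⊎ ProbeOnPointBlocks L i
  classify L i with finite-dichotomy (suppBound (probe L i)) (λ y _ → escape-or-pointBlock? y)
    where
      escape-or-pointBlock? : ∀ y → HasEscape L i ⊎ (val (probe L i) y ≢ 0 → PointBlock k≥1 (A i) y)
      escape-or-pointBlock? y with val (probe L i) y ≟ 0
      ... | yes ≡0 = inj₂ (λ ≢0 → ⊥-elim (≢0 ≡0))
      ... | no ≢0 = map₂ (λ pb _ → pb) (escape-or-pointBlock L i ≢0)
  ... | inj₁ (_ , _ , escape) = inj₁ escape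
  ... | inj₂ onPoints = inj₂ (λ y ≢0 → onPoints y (supp<suppBound (probe L i) ≢0) ≢0)

  pieceOf : ∀ {L i} → HasEscape L i ⊎ ProbeOnPointBlocks L i → FIN k
  pieceOf (inj₁ (d , _)) = point d
  pieceOf {L} {i} (inj₂ _) = probe L i

  pieceOf-supp : ∀ {L i} (e⊎p : HasEscape L i ⊎ ProbeOnPointBlocks L i) {z} →
                 val (pieceOf e⊎p) z ≢ 0 → L ≤ z < pieceEnd L i
  pieceOf-supp {L} {i} (inj₁ (d , d∈ , _)) ≢0 = subst (λ y → L ≤ y < pieceEnd L i) (sym (pointVal-≢0 ≢0)) d∈
  pieceOf-supp {L} {i} (inj₂ _) = probe-in-region L i

  piece : ℕ → ℕ → FIN k
  piece L i = pieceOf (classify L i)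

  pieceStart : ℕ → ℕ → ℕ
  pieceStart L zero = L
  pieceStart L (suc i) = pieceEnd (pieceStart L i) i

  blockStart : ℕ → ℕ
  blockStart zero = 0
  blockStart (suc n) = pieceStart (blockStart n) (suc n)

  module QBlock (n : ℕ) =
    Glue k≥1 (λ i → piece (pieceStart (blockStart n) i) i) (pieceStart (blockStart n)) (λ i → pieceOf-supp (classify _ i))

  Q : BlockSeq k
  Q = record
    { blk = λ n → QBlock.glue n n
    ; incr = λ n u v u≢0 v≢0 →
        <-≤-trans (proj₂ (QBlock.sum-supp n (suc n) u≢0)) (proj₁ (QBlock.sum-supp (suc n) (suc (suc n)) v≢0))
    }

  Q-supp : ∀ n {z} → val (blk Q n) z ≢ 0 → blockStart n ≤ z < blockStart (suc n)
  Q-supp n = QBlock.sum-supp n (suc n)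

  blockStart-step : ∀ n → blockStart n < blockStart (suc n)
  blockStart-step n = <-≤-trans (QBlock.r-step n 0) (QBlock.r-mono n (s≤s z≤n))

  blockStart-mono : ∀ {n n′} → n ≤ n′ → blockStart n ≤ blockStart n′
  blockStart-mono = step⇒monotone blockStart (λ n → <⇒≤ (blockStart-step n))

  n≤blockStart : ∀ n → n ≤ blockStart n
  n≤blockStart zero = z≤n
  n≤blockStart (suc n) = ≤-<-trans (n≤blockStart n) (blockStart-step n)

  piece-in-block : ∀ {n i z} → i ≤ n → pieceStart (blockStart n) i ≤ z < pieceStart (blockStart n) (suc i) →
                   blockStart n ≤ z < blockStart (suc n)
  piece-in-block {n} {i} i≤n (lo , hi) =
    ≤-trans (QBlock.r-mono n {0} {i} z≤n) lo , <-≤-trans hi (QBlock.r-mono n (s≤s i≤n))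

  Q-on-piece : ∀ {n i z} → i ≤ n → pieceStart (blockStart n) i ≤ z < pieceStart (blockStart n) (suc i) →
               val (blk Q n) z ≡ val (piece (pieceStart (blockStart n) i) i) z
  Q-on-piece {n} i≤n = QBlock.sum-inside n (suc n) (s≤s i≤n)

  Q-others-vanish : ∀ {n n′ z} → n′ ≢ n → blockStart n ≤ z < blockStart (suc n) → val (blk Q n′) z ≡ 0
  Q-others-vanish {n} {n′} {z} n′≢n (lo , hi) = decidable-stable (val (blk Q n′) z ≟ 0) disjoint
    where
      disjoint : ¬ (val (blk Q n′) z ≢ 0)
      disjoint ≢0 with <-cmp n n′ | Q-supp n′ ≢0
      ... | tri< n<n′ _ _ | lo′ , _ = <⇒≱ hi (≤-trans (blockStart-mono n<n′) lo′)
      ... | tri≈ _ n≡n′ _ | _ = n′≢n (sym n≡n′)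
      ... | tri> _ _ n′<n | _ , hi′ = <⇒≱ hi′ (≤-trans (blockStart-mono n′<n) lo)

  dominated⇒probeOnPointBlocks : ∀ {i n} (x : FIN k) → i ≤ n → x ∈⟨ A i ⟩ → (∀ z → val (blk Q n) z ≤ val x z) →
              (∀ {z} → Uncovered k≥1 Q z → val x z ≡ 0) → ProbeOnPointBlocks (pieceStart (blockStart n) i) i
  dominated⇒probeOnPointBlocks {i} {n} x i≤n x∈A Qn≤x x-off-Q = from-classification (classify L i) (Q-on-piece i≤n)
    where
      L = pieceStart (blockStart n) i
      from-classification : (e⊎p : HasEscape L i ⊎ ProbeOnPointBlocks L i) →
                            (∀ {z} → L ≤ z < pieceEnd L i → val (blk Q n) z ≡ val (pieceOf e⊎p) z) →
                            ProbeOnPointBlocks L i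
      from-classification (inj₂ onPoints) _ = onPoints
      from-classification (inj₁ (d , d∈ , escapes)) Qn≡point =
        ⊥-elim (≡k⇒≢0 k≥1 (trans (Qn≡point d∈) (pointVal-same d))
                          (n≤0⇒n≡0 (subst (_ ≤_) x-d≡0 (Qn≤x d))))
        where
          Q-off-d : ∀ {z} → L ≤ z < pieceEnd L i → z ≢ d → Uncovered k≥1 Q z
          Q-off-d z∈ z≢d n′ with n′ ≟ n
          ... | yes refl = trans (Qn≡point z∈) (pointVal-other z≢d)
          ... | no n′≢n = Q-others-vanish n′≢n (piece-in-block i≤n z∈)
          x-d≡0 : val x d ≡ 0
          x-d≡0 = escapes x x∈A (λ z z∈ z≢d → x-off-Q (Q-off-d z∈ z≢d))

  module _ (i : ℕ) (R : BlockSeq k) (R⊆ : ∀ p → p ∈⟨ R ⟩ → (p ∈⟨ Q ⟩) × (p ∈⟨ A i ⟩)) where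

    probesOnPointBlocks-unbounded : ∀ N → ∃ λ L → N ≤ L × ProbeOnPointBlocks L i
    probesOnPointBlocks-unbounded N =
      pieceStart (blockStart n) i , N≤L ,
      dominated⇒probeOnPointBlocks {i} {n} x i≤n x∈A Qn≤x (∈⟨⟩-vanishes k≥1 Q x x∈Q)
      where
        t = N ⊔ i
        x = blk R (blockStart t)
        x∈Q = proj₁ (R⊆ x (blk-∈⟨⟩ k≥1 R _))
        x∈A = proj₂ (R⊆ x (blk-∈⟨⟩ k≥1 R _))
        n = proj₁ (∈⟨⟩-dominates k≥1 Q x x∈Q)
        Qn≤x = proj₂ (∈⟨⟩-dominates k≥1 Q x x∈Q)
        peak≢0 = peak-≢0 k≥1 (blk Q n)
        x≢0 : val x (peak (blk Q n)) ≢ 0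
        x≢0 ≡0 = peak≢0 (n≤0⇒n≡0 (subst (val (blk Q n) (peak (blk Q n)) ≤_) ≡0 (Qn≤x (peak (blk Q n)))))
        t≤n : t ≤ n
        t≤n with t ≤? n
        ... | yes t≤n = t≤n
        ... | no t≰n = ⊥-elim (<⇒≱ (proj₂ (Q-supp n peak≢0))
                                   (≤-trans (blockStart-mono (≰⇒> t≰n)) (index≤supp k≥1 R _ x≢0)))
        i≤n = ≤-trans (m≤n⊔m N i) t≤n
        N≤L = ≤-trans (≤-trans (m≤m⊔n N i) t≤n) (≤-trans (n≤blockStart n) (QBlock.r-mono n {0} {i} z≤n))

  Q-almostDisjoint : IsADSeq A → ∀ i → AlmostDisjoint Q (A i)
  Q-almostDisjoint ad i (R , R⊆) =
    ad i (suc i) (≢-sym 1+n≢n) (R′ , λ p p∈R′ →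
      pointBlocks⇒∈⟨⟩ k≥1 (A i) p (pointBlocks p p∈R′) , subseq-⊆ k≥1 (A (suc i)) idx idx-step p p∈R′)
    where
      next : ∀ N → ∃ λ L → N ≤ L × ProbeOnPointBlocks L i
      next = probesOnPointBlocks-unbounded i R R⊆
      L : ℕ → ℕ
      L zero = proj₁ (next 0)
      L (suc t) = proj₁ (next (pieceEnd (L t) i))
      L-onPointBlocks : ∀ t → ProbeOnPointBlocks (L t) i
      L-onPointBlocks zero = proj₂ (proj₂ (next 0))
      L-onPointBlocks (suc t) = proj₂ (proj₂ (next (pieceEnd (L t) i)))
      idx : ℕ → ℕ
      idx t = probeIndex (L t) i
      idx-step : ∀ t → idx t < idx (suc t)
      idx-step t =
        let (lo , hi) = probe-supp (L t) i (peak-≢0 k≥1 (probe (L t) i)) in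
        ≤-<-trans lo (<-≤-trans hi (≤-trans (proj₁ (proj₂ (next (pieceEnd (L t) i)))) (m≤m⊔n _ _)))
      R′ : BlockSeq k
      R′ = subseq k≥1 (A (suc i)) idx idx-step
      pointBlocks : ∀ p → p ∈⟨ R′ ⟩ → ∀ y → val p y ≢ 0 → PointBlock k≥1 (A i) y
      pointBlocks p p∈R′ y ≢0 = let (t , t≢0) = ∈⟨⟩-supp k≥1 R′ p p∈R′ ≢0 in L-onPointBlocks t y t≢0

theorem1p4 : ∀ (k : ℕ) → k ≥ 1 → ∀ (A : ℕ → BlockSeq k) → IsADSeq A → ¬ IsMaximal A
theorem1p4 k k≥1 A ad maximal =
  let (i , Q≐Aᵢ) = maximal Q (λ i → inj₂ (Q-almostDisjoint ad i))
  in ≐⇒¬AlmostDisjoint Q≐Aᵢ (Q-almostDisjoint ad i)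
  where open Construction k≥1 A
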